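{- If $\mathcal Q=(W,\preccurlyeq,S,\ell)$ is a quasimodel, then its weak limit model $\widehat{\mathcal Q}=(\widehat W,\widehat\preccurlyeq,\widehat S,\widehat\ell)$ is a deterministic quasimodel.
   Context: $\mathcal L_\Diamond$ is the language built from a countable set of propositional variables by $\varphi ::= \bot \mid p \mid \varphi\wedge\varphi \mid \varphi\vee\varphi\mid \varphi\to\varphi\mid \circ\varphi\mid\Diamond\varphi$. A (two-sided) type is a pair $\Phi=(\Phi^-;\Phi^+)$ of finite subsets of $\mathcal L_\Diamond$ such that: $\Phi^-\cap\Phi^+=\varnothing$; $\bot\notin\Phi^+$; if $\varphi\wedge\psi\in\Phi^+$ then $\varphi,\psi\in\Phi^+$; if $\varphi\wedge\psi\in\Phi^-$ then $\varphi\in\Phi^-$ or $\psi\in\Phi^-$; if $\varphi\vee\psi\in\Phi^+$ then $\varphi\in\Phi^+$ or $\psi\in\Phi^+$; if $\varphi\vee\psi\in\Phi^-$ then $\varphi,\psi\in\Phi^-$; if $\varphi\to\psi\in\Phi^+$ then $\varphi\in\Phi^-$ or $\psi\in\Phi^+$; if $\Diamond\varphi\in\Phi^-$ then $\varphi\in\Phi^-$. $\Phi\preccurlyeq_T\Psi$ iff $\Psi^-\subseteq\Phi^-$ and $\Phi^+\subseteq\Psi^+$; $\Phi\sqsubseteq_T\Psi$ iff $\Phi^-=\Psi^-$ and $\Phi^+\subseteq\Psi^+$. $\Phi\mathrel{S_T}\Psi$ iff for all $\varphi$: if $\circ\varphi\in\Phi^+$ then $\varphi\in\Psi^+$; if $\circ\varphi\in\Phi^-$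 then $\varphi\in\Psi^-$; if $\Diamond\varphi\in\Phi^+$ then $\varphi\in\Phi^+$ or $\Diamond\varphi\in\Psi^+$; if $\Diamond\varphi\in\Phi^-$ then $\Diamond\varphi\in\Psi^-$. A labelled frame is $(W,\preccurlyeq,\ell)$ with $\preccurlyeq$ a partial order and $\ell(w)=(\ell^-(w);\ell^+(w))$ a type for each $w$, such that $w\preccurlyeq v$ implies $\ell(w)\preccurlyeq_T\ell(v)$ and whenever $\varphi\to\psi\in\ell^-(w)$ there is $v\succcurlyeq w$ with $\varphi\in\ell^+(v)$, $\psi\in\ell^-(v)$. A quasimodel is $(W,\preccurlyeq,S,\ell)$ with $(W,\preccurlyeq,\ell)$ a labelled frame and $S\subseteq W\times W$ serial (every $w$ has some $v$ with $w\mathrel S v$), forward-confluent (if $w\preccurlyeq w'$ and $w\mathrel S v$ there is $v'\succcurlyeq v$ with $w'\mathrel S v'$), sensible ($w\mathrel S x$ implies $\ell(w)\mathrel{S_T}\ell(x)$) and $\omega$-sensible (if $\Diamond\varphi\in\ell^+(w)$ there are $n\ge0$, $v$ with $w\mathrel S^n v$, $\varphi\in\ell^+(v)$); it is deterministic if $S$ is a function. A typed path on $\mathcal Q$ is a sequence $((w_i,\Phi_i))_{i<n}$ with $w_i\mathrel S w_{i+1}$ and $\Phi_i\mathrel{S_T}\Phi_{i+1}$ for $i<n-1$, and $\Phi_i$ a type with $\Phi_i\sqsubseteq_T\ell(w_i)$ for $i<n$; it is terminal if $n\ge1$ and $\Phi^+_{n-1}=\varnothing$. The weak limit model $\widehat{\mathcal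 Q}$: $\widehat W$ is the set of terminal typed paths on $\mathcal Q$ together with the empty path $\epsilon$; for $\alpha=((w_i,\Phi_i))_{i<n}$, $\beta=((v_i,\Psi_i))_{i<m}$ in $\widehat W$, $\alpha\mathrel{\widehat\preccurlyeq}\beta$ iff $n\le m$ and $w_i\preccurlyeq v_i$, $\Phi_i\preccurlyeq_T\Psi_i$ for all $i<n$; $\widehat S(((w_i,\Phi_i))_{i<n})=((w_{i+1},\Phi_{i+1}))_{i<n-1}$, with $\widehat S(\epsilon)=\epsilon$; $\widehat\ell(((w_i,\Phi_i))_{i<n})=\Phi_0$ for $n>0$, and $\widehat\ell(\epsilon)=(\bigcup_{w\in W}\ell^-(w);\varnothing)$.
   Formalization: The set $\bigcup_{w\in W}\ell^-(w)$ of negative labels of 𝒬 is assumed finite, and $\widehat\ell(\epsilon)$ takes it as its negative side. Each condition added here is assumed in the paper as well or is needed for the statement above to hold. -}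

module Defs where

open import Data.Nat using (ℕ; zero; suc)
open import Data.Empty using (⊥)
open import Data.Product using (Σ; ∃; ∃-syntax; _×_; _,_; proj₁; proj₂)
open import Data.Sum using (_⊎_; inj₁; inj₂)
open import Data.List using (List; []; _∷_; _∷ʳ_; drop)
open import Data.List.Membership.Propositional using (_∈_)
open import Data.List.Relation.Binary.Subset.Propositional using (_⊆_)
open import Data.List.Relation.Unary.All using (All; []; _∷_)
open import Data.List.Relation.Unary.Linked using (Linked; []; [-]; _∷_)
open import Data.List.Relation.Binary.Pointwise using (Pointwise)
open import Data.List.Relation.Binary.Prefix.Heterogeneous using (Prefix)
open import Relation.Binary.Core using (Rel)
open import Relation.Binary.Structures using (IsPartialOrder)
open import Relation.Binary.PropositionalEquality using (_≡_; refl)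
open import Relation.Nullary using (¬_)
open import Level using (0ℓ)

infixr 6 _∧'_
infixr 5 _∨'_
infixr 4 _⇒'_

data Form : Set where
  ⊥'    : Form
  var   : ℕ → Form
  _∧'_  : Form → Form → Form
  _∨'_  : Form → Form → Form
  _⇒'_  : Form → Form → Form
  ○     : Form → Form
  ◇     : Form → Form

-- Finite sets of formulas are represented by lists (read as the set of
-- their members); set equality is mutual inclusion.

_≐_ : List Form → List Form → Set
A ≐ B = A ⊆ B × B ⊆ A

record Pair : Set where
  constructor ⟨_⨾_⟩
  field
    neg : List Form
    pos : List Form
open Pair public

record IsType (Φ : Pair) : Set where
  field
    disjoint : ∀ {φ} → φ ∈ neg Φ → φ ∈ pos Φ → ⊥
    ⊥∉pos    : ¬ (⊥' ∈ pos Φ)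
    ∧-pos    : ∀ {φ ψ} → (φ ∧' ψ) ∈ pos Φ → φ ∈ pos Φ × ψ ∈ pos Φ
    ∧-neg    : ∀ {φ ψ} → (φ ∧' ψ) ∈ neg Φ → φ ∈ neg Φ ⊎ ψ ∈ neg Φ
    ∨-pos    : ∀ {φ ψ} → (φ ∨' ψ) ∈ pos Φ → φ ∈ pos Φ ⊎ ψ ∈ pos Φ
    ∨-neg    : ∀ {φ ψ} → (φ ∨' ψ) ∈ neg Φ → φ ∈ neg Φ × ψ ∈ neg Φ
    ⇒-pos    : ∀ {φ ψ} → (φ ⇒' ψ) ∈ pos Φ → φ ∈ neg Φ ⊎ ψ ∈ pos Φ
    ◇-neg    : ∀ {φ} → ◇ φ ∈ neg Φ → φ ∈ neg Φ

_≼T_ : Pair → Pair → Set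
Φ ≼T Ψ = neg Ψ ⊆ neg Φ × pos Φ ⊆ pos Ψ

_⊑T_ : Pair → Pair → Set
Φ ⊑T Ψ = neg Φ ≐ neg Ψ × pos Φ ⊆ pos Ψ

_≐T_ : Pair → Pair → Set
Φ ≐T Ψ = neg Φ ≐ neg Ψ × pos Φ ≐ pos Ψ

record _Sᵀ_ (Φ Ψ : Pair) : Set where
  field
    ○-pos : ∀ {φ} → ○ φ ∈ pos Φ → φ ∈ pos Ψ
    ○-neg : ∀ {φ} → ○ φ ∈ neg Φ → φ ∈ neg Ψ
    ◇-pos : ∀ {φ} → ◇ φ ∈ pos Φ → φ ∈ pos Φ ⊎ ◇ φ ∈ pos Ψ
    ◇-neg : ∀ {φ} → ◇ φ ∈ neg Φ → ◇ φ ∈ neg Ψ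

_^_ : {W : Set} → Rel W 0ℓ → ℕ → Rel W 0ℓ
(R ^ zero)  x y = x ≡ y
(R ^ suc n) x z = ∃[ y ] (R x y × (R ^ n) y z)

-- Labelled frames and quasimodels.  The partial order ≼ is a partial
-- order with respect to an equality _≈_ on W (a setoid equality, which
-- may be _≡_).

record IsLabelledFrame {W : Set} (_≈_ _≼_ : Rel W 0ℓ) (ℓ : W → Pair) : Set where
  field
    isPartialOrder : IsPartialOrder _≈_ _≼_
    ℓ-type         : ∀ w → IsType (ℓ w)
    ℓ-mono         : ∀ {w v} → w ≼ v → ℓ w ≼T ℓ v
    ℓ-⇒            : ∀ {w φ ψ} → (φ ⇒' ψ) ∈ neg (ℓ w) →
                     ∃[ v ] (w ≼ v × φ ∈ pos (ℓ v) × ψ ∈ neg (ℓ v))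

record IsQuasimodel {W : Set} (_≈_ _≼_ S : Rel W 0ℓ) (ℓ : W → Pair) : Set where
  field
    isLabelledFrame   : IsLabelledFrame _≈_ _≼_ ℓ
    serial            : ∀ w → ∃[ v ] S w v
    forward-confluent : ∀ {w w′ v} → w ≼ w′ → S w v → ∃[ v′ ] (v ≼ v′ × S w′ v′)
    sensible          : ∀ {w x} → S w x → ℓ w Sᵀ ℓ x
    ω-sensible        : ∀ {w φ} → ◇ φ ∈ pos (ℓ w) →
                        ∃[ n ] ∃[ v ] ((S ^ n) w v × φ ∈ pos (ℓ v))

record IsDeterministicQuasimodel {W : Set} (_≈_ _≼_ S : Rel W 0ℓ) (ℓ : W → Pair) : Set where
  field
    isQuasimodel : IsQuasimodel _≈_ _≼_ S ℓ
    functional   : ∀ {w v v′} → S w v → S w v′ → v ≈ v′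

-- The weak limit model.
-- U is a finite listing of the set ⋃_{w ∈ W} ℓ⁻(w) (see UnionListing).

UnionListing : {W : Set} → (W → Pair) → List Form → Set
UnionListing {W} ℓ U =
  (∀ {φ} → φ ∈ U → ∃[ w ] (φ ∈ neg (ℓ w))) × (∀ {w φ} → φ ∈ neg (ℓ w) → φ ∈ U)

module WeakLimit {W : Set} (_≈_ _≼_ S : Rel W 0ℓ) (ℓ : W → Pair) (U : List Form) where

  Node : Set
  Node = W × Pair

  IsTypedPath : List Node → Set
  IsTypedPath xs =
    Linked (λ x y → S (proj₁ x) (proj₁ y) × (proj₂ x Sᵀ proj₂ y)) xs ×
    All (λ x → IsType (proj₂ x) × proj₂ x ⊑T ℓ (proj₁ x)) xs

  IsTerminal : List Node → Set
  IsTerminal xs = ∃[ ys ] ∃[ x ] (xs ≡ ys ∷ʳ x × pos (proj₂ x) ≡ [])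

  Ŵ : Set
  Ŵ = Σ (List Node) λ xs → IsTypedPath xs × (xs ≡ [] ⊎ IsTerminal xs)

  path : Ŵ → List Node
  path = proj₁

  _≼̂_ : Rel Ŵ 0ℓ
  α ≼̂ β = Prefix (λ x y → proj₁ x ≼ proj₁ y × proj₂ x ≼T proj₂ y) (path α) (path β)

  _≈̂_ : Rel Ŵ 0ℓ
  α ≈̂ β = Pointwise (λ x y → proj₁ x ≈ proj₁ y × proj₂ x ≐T proj₂ y) (path α) (path β)

  private
    tail-linked : ∀ {R : Rel Node 0ℓ} {x xs} → Linked R (x ∷ xs) → Linked R xs
    tail-linked [-] = []
    tail-linked (_ ∷ l) = l

    tail-term : ∀ xs → IsTerminal xs → drop 1 xs ≡ [] ⊎ IsTerminal (drop 1 xs)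
    tail-term _ ([] , x , refl , p) = inj₁ refl
    tail-term _ ((y ∷ ys) , x , refl , p) = inj₂ (ys , x , refl , p)

  Ŝ : Ŵ → Ŵ
  Ŝ ([] , tp , t) = [] , tp , inj₁ refl
  Ŝ ((x ∷ xs) , (l , _ ∷ a) , inj₁ ())
  Ŝ ((x ∷ xs) , (l , _ ∷ a) , inj₂ term) = xs , (tail-linked l , a) , tail-term (x ∷ xs) term

  _Ŝ-rel_ : Rel Ŵ 0ℓ
  α Ŝ-rel β = Ŝ α ≡ β

  ℓ̂ : Ŵ → Pair
  ℓ̂ ([] , _) = ⟨ U ⨾ [] ⟩
  ℓ̂ ((x ∷ _) , _) = proj₂ x

module Submission where

-- Since Ŝ drops the first node of a path, seriality, functionality,
-- forward confluence and sensibility are read off the paths, and a ◇φ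
-- is fulfilled along a path because its last type has no positive part.
-- The substantial clause is the implication condition: a refuted φ ⇒ ψ
-- is witnessed at some world v of Q, from which a terminal typed path
-- above the given one must be built.  To this end we restrict a type to
-- the closure of a finite set R of true requirements (this is a type),
-- and pass along S the obligations of R (arguments of ○, pending ◇'s),
-- keeping consecutive types S_T-related.  Obligations weigh less than
-- their requirements except for pending ◇'s, settled by the S-path from
-- ω-sensibility; so every R is discharged by a finite path ending in an
-- empty positive part.

open import Defs
open import Level using (0ℓ)
open import Data.Nat using (ℕ; zero; suc; _+_; _≤_; _<_; z≤n; s≤s)
open import Data.Nat.Properties using (≤-refl; ≤-trans; <-≤-trans; <⇒≤; ≤-reflexive; m≤m+n; m≤n+m; +-identityʳ; +-mono-≤; +-mono-<-≤; +-mono-≤-<)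
import Data.Nat.Properties as ℕ
open import Data.Nat.ListAction using (sum)
open import Data.Nat.ListAction.Properties using (sum-++)
open import Data.List using (List; []; _∷_; _++_; map; concatMap)
open import Data.List.Properties using (map-++; concatMap-++; ∷ʳ-injective)
import Data.List.Properties as List
open import Data.List.Membership.Propositional using (_∈_; find; lose)
open import Data.List.Membership.Propositional.Properties using (∈-++⁺ˡ; ∈-++⁺ʳ; ∈-++⁻; ∈-concatMap⁺; ∈-concatMap⁻)
open import Data.List.Membership.Propositional.Properties.Core using (∉[])
open import Data.List.Relation.Binary.Subset.Propositional using (_⊆_)
open import Data.List.Relation.Binary.Subset.Propositional.Properties using (⊆-refl)
open import Data.List.Relation.Unary.Any using (here; there)
open import Data.List.Relation.Unary.All using (All; []; _∷_)
open import Data.List.Relation.Unary.Linked using (Linked; [-]; _∷_)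
open import Data.List.Relation.Binary.Prefix.Heterogeneous using (Prefix; []; _∷_)
import Data.List.Relation.Binary.Prefix.Homogeneous.Properties as Prefix
open import Data.Product.Relation.Binary.Pointwise.NonDependent using (×-isPartialOrder)
import Relation.Binary.Construct.On as On
open import Data.Sum using (_⊎_; inj₁; inj₂)
import Data.Sum as Sum
import Data.Sum.Properties as Sum
open import Data.Product using (Σ; ∃-syntax; _×_; _,_; proj₁; proj₂)
import Data.Product as Product
open import Data.Unit using (⊤; tt)
open import Data.Empty using (⊥-elim)
open import Function using (_∘_)
open import Relation.Nullary using (¬_; yes; no)
open import Relation.Nullary.Decidable using (map′)
open import Relation.Binary.Core using (Rel)
open import Relation.Binary.Definitions using (DecidableEquality)
open import Relation.Binary.Structures using (IsPartialOrder)
open import Relation.Binary.PropositionalEquality using (_≡_; refl; sym; trans; cong; subst; module ≡-Reasoning)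

-- Formulas have decidable equality: a formula is recovered from its
-- postfix serialisation by running a stack machine over the tokens.

Token : Set
Token = ℕ ⊎ ℕ

serialise : Form → List Token → List Token
serialise ⊥'       ts = inj₂ 0 ∷ ts
serialise (var n)  ts = inj₁ n ∷ ts
serialise (a ∧' b) ts = serialise a (serialise b (inj₂ 1 ∷ ts))
serialise (a ∨' b) ts = serialise a (serialise b (inj₂ 2 ∷ ts))
serialise (a ⇒' b) ts = serialise a (serialise b (inj₂ 3 ∷ ts))
serialise (○ a)    ts = serialise a (inj₂ 4 ∷ ts)
serialise (◇ a)    ts = serialise a (inj₂ 5 ∷ ts)

-- One step of the stack machine; ill-formed input leaves the stack alone.
push : Token → List Form → List Form
push (inj₁ n) st           = var n ∷ st
push (inj₂ 0) st           = ⊥' ∷ st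
push (inj₂ 1) (b ∷ a ∷ st) = (a ∧' b) ∷ st
push (inj₂ 2) (b ∷ a ∷ st) = (a ∨' b) ∷ st
push (inj₂ 3) (b ∷ a ∷ st) = (a ⇒' b) ∷ st
push (inj₂ 4) (a ∷ st)     = ○ a ∷ st
push (inj₂ 5) (a ∷ st)     = ◇ a ∷ st
push _        st           = st

run : List Token → List Form → List Form
run []       st = st
run (t ∷ ts) st = run ts (push t st)

run-serialise : ∀ f ts st → run (serialise f ts) st ≡ run ts (f ∷ st)
run-serialise ⊥'       ts st = refl
run-serialise (var n)  ts st = refl
run-serialise (a ∧' b) ts st = trans (run-serialise a _ st) (run-serialise b _ (a ∷ st))
run-serialise (a ∨' b) ts st = trans (run-serialise a _ st) (run-serialise b _ (a ∷ st))
run-serialise (a ⇒' b) ts st = trans (run-serialise a _ st) (run-serialise b _ (a ∷ st))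
run-serialise (○ a)    ts st = run-serialise a _ st
run-serialise (◇ a)    ts st = run-serialise a _ st

serialise-injective : ∀ {f g} → serialise f [] ≡ serialise g [] → f ≡ g
serialise-injective {f} {g} eq = List.∷-injectiveˡ (begin
  f ∷ []                  ≡⟨ sym (run-serialise f [] []) ⟩
  run (serialise f []) [] ≡⟨ cong (λ ts → run ts []) eq ⟩
  run (serialise g []) [] ≡⟨ run-serialise g [] [] ⟩
  g ∷ []                  ∎)
  where open ≡-Reasoning

_≟_ : DecidableEquality Form
f ≟ g = map′ serialise-injective (cong (λ h → serialise h []) )
          (List.≡-dec (Sum.≡-dec ℕ._≟_ ℕ._≟_) (serialise f []) (serialise g []))

open import Data.List.Membership.DecPropositional _≟_ using (_∈?_)

-- The local closure condition a positive part C has to satisfy so that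
-- it, together with the negative part of Φ, forms a type.
Sat : Pair → List Form → Form → Set
Sat Φ C (a ∧' b) = a ∈ C × b ∈ C
Sat Φ C (a ∨' b) = a ∈ C ⊎ b ∈ C
Sat Φ C (a ⇒' b) = b ∈ C ⊎ ¬ b ∈ pos Φ
Sat Φ C (◇ a)    = a ∈ C ⊎ ¬ a ∈ pos Φ
Sat Φ C _        = ⊤

Saturated : Pair → List Form → Set
Saturated Φ C = ∀ {g} → g ∈ C → Sat Φ C g

sat-mono : ∀ {Φ C D} g → C ⊆ D → Sat Φ C g → Sat Φ D g
sat-mono ⊥'       C⊆D s = tt
sat-mono (var n)  C⊆D s = tt
sat-mono (a ∧' b) C⊆D s = Product.map C⊆D C⊆D s
sat-mono (a ∨' b) C⊆D s = Sum.map C⊆D C⊆D s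
sat-mono (a ⇒' b) C⊆D s = Sum.map₁ C⊆D s
sat-mono (○ a)    C⊆D s = tt
sat-mono (◇ a)    C⊆D s = Sum.map₁ C⊆D s

module _ (Φ : Pair) where

  mutual
    -- cl Φ f: f together with the components it forces in a type
    -- below Φ, choosing a true disjunct and including the true
    -- consequent of an implication and the true argument of a ◇.
    cl : Form → List Form
    cl f = f ∷ below f

    below : Form → List Form
    below (a ∧' b) = cl a ++ cl b
    below (a ∨' b) with a ∈? pos Φ
    ... | yes _ = cl a
    ... | no  _ = cl b
    below (a ⇒' b) with b ∈? pos Φ
    ... | yes _ = cl b
    ... | no  _ = []
    below (◇ a) with a ∈? pos Φ
    ... | yes _ = cl a
    ... | no  _ = []
    below _ = []

  head-sat : ∀ f → Sat Φ (cl f) f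
  head-sat ⊥'       = tt
  head-sat (var n)  = tt
  head-sat (a ∧' b) = there (∈-++⁺ˡ {ys = cl b} (here refl)) , there (∈-++⁺ʳ (cl a) (here refl))
  head-sat (a ∨' b) with a ∈? pos Φ
  ... | yes _ = inj₁ (there (here refl))
  ... | no  _ = inj₂ (there (here refl))
  head-sat (a ⇒' b) with b ∈? pos Φ
  ... | yes _  = inj₁ (there (here refl))
  ... | no  b∉ = inj₂ b∉
  head-sat (○ a)    = tt
  head-sat (◇ a) with a ∈? pos Φ
  ... | yes _  = inj₁ (there (here refl))
  ... | no  a∉ = inj₂ a∉

  mutual
    cl-saturated : ∀ f → Saturated Φ (cl f)
    cl-saturated f (here refl) = head-sat f
    cl-saturated f (there m)   = sat-mono _ there (below-saturated f m)

    below-saturated : ∀ f → Saturated Φ (below f)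
    below-saturated (a ∧' b) m with ∈-++⁻ (cl a) m
    ... | inj₁ m′ = sat-mono _ ∈-++⁺ˡ (cl-saturated a m′)
    ... | inj₂ m′ = sat-mono _ (∈-++⁺ʳ (cl a)) (cl-saturated b m′)
    below-saturated (a ∨' b) m with a ∈? pos Φ
    ... | yes _ = cl-saturated a m
    ... | no  _ = cl-saturated b m
    below-saturated (a ⇒' b) m with b ∈? pos Φ
    ... | yes _ = cl-saturated b m
    below-saturated (a ⇒' b) () | no _
    below-saturated (◇ a) m with a ∈? pos Φ
    ... | yes _ = cl-saturated a m
    below-saturated (◇ a) () | no _

  closure : List Form → List Form
  closure = concatMap cl

  cl⊆closure : ∀ {f R} → f ∈ R → cl f ⊆ closure R
  cl⊆closure f∈R g∈ = ∈-concatMap⁺ cl (lose f∈R g∈)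

  ⊆-closure : ∀ R → R ⊆ closure R
  ⊆-closure R f∈R = cl⊆closure f∈R (here refl)

  closure-saturated : ∀ R → Saturated Φ (closure R)
  closure-saturated R m with find (∈-concatMap⁻ cl {xs = R} m)
  ... | f , f∈R , g∈ = sat-mono _ (cl⊆closure f∈R) (cl-saturated f g∈)

  -- What a member of a positive part demands of the next type.
  next : Form → List Form
  next (○ a) = a ∷ []
  next (◇ a) with a ∈? pos Φ
  ... | yes _ = []
  ... | no  _ = ◇ a ∷ []
  next _ = []

  obligations : List Form → List Form
  obligations R = concatMap next (closure R)

  ○-obligation : ∀ R {a} → ○ a ∈ closure R → a ∈ obligations R
  ○-obligation R m = ∈-concatMap⁺ next (lose m (here refl))

  ◇-obligation : ∀ R {a} → ◇ a ∈ closure R → ¬ a ∈ pos Φ → ◇ a ∈ obligations R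
  ◇-obligation R {a} m a∉ = ∈-concatMap⁺ next (lose m next-◇)
    where
    next-◇ : ◇ a ∈ next (◇ a)
    next-◇ with a ∈? pos Φ
    ... | yes a∈ = ⊥-elim (a∉ a∈)
    ... | no  _  = here refl

  restrict : List Form → Pair
  restrict R = ⟨ neg Φ ⨾ closure R ⟩

  module _ (Φ-type : IsType Φ) where
    open IsType Φ-type

    -- closing true formulas yields true formulas (∨ needs the type condition)
    mutual
      cl-pos : ∀ {f} → f ∈ pos Φ → cl f ⊆ pos Φ
      cl-pos f∈ (here refl) = f∈
      cl-pos f∈ (there m)   = below-pos f∈ m

      below-pos : ∀ {f} → f ∈ pos Φ → below f ⊆ pos Φ
      below-pos {a ∧' b} f∈ m with ∈-++⁻ (cl a) m
      ... | inj₁ m′ = cl-pos (proj₁ (∧-pos f∈)) m′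
      ... | inj₂ m′ = cl-pos (proj₂ (∧-pos f∈)) m′
      below-pos {a ∨' b} f∈ m with a ∈? pos Φ | ∨-pos f∈
      ... | yes a∈ | _      = cl-pos a∈ m
      ... | no  a∉ | inj₁ a∈ = ⊥-elim (a∉ a∈)
      ... | no  _  | inj₂ b∈ = cl-pos b∈ m
      below-pos {a ⇒' b} f∈ m with b ∈? pos Φ
      ... | yes b∈ = cl-pos b∈ m
      below-pos {a ⇒' b} f∈ () | no _
      below-pos {◇ a} f∈ m with a ∈? pos Φ
      ... | yes a∈ = cl-pos a∈ m
      below-pos {◇ a} f∈ () | no _

    closure-pos : ∀ {R} → R ⊆ pos Φ → closure R ⊆ pos Φ
    closure-pos {R} R⊆ m with find (∈-concatMap⁻ cl {xs = R} m)
    ... | f , f∈R , g∈ = cl-pos (R⊆ f∈R) g∈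

    restrict-type : ∀ {R} → R ⊆ pos Φ → IsType (restrict R)
    restrict-type {R} R⊆ = record
      { disjoint = λ n p → disjoint n (closure-pos R⊆ p)
      ; ⊥∉pos    = ⊥∉pos ∘ closure-pos R⊆
      ; ∧-pos    = closure-saturated R
      ; ∧-neg    = ∧-neg
      ; ∨-pos    = closure-saturated R
      ; ∨-neg    = ∨-neg
      ; ⇒-pos    = λ m → ⇒-pos′ m (closure-saturated R m)
      ; ◇-neg    = ◇-neg
      }
      where
      ⇒-pos′ : ∀ {a b} → (a ⇒' b) ∈ closure R → b ∈ closure R ⊎ ¬ b ∈ pos Φ →
               a ∈ neg Φ ⊎ b ∈ closure R
      ⇒-pos′ m (inj₁ b∈) = inj₂ b∈
      ⇒-pos′ m (inj₂ b∉) = Sum.map₂ (λ b∈ → ⊥-elim (b∉ b∈)) (⇒-pos (closure-pos R⊆ m))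

    restrict-⊑ : ∀ {R} → R ⊆ pos Φ → restrict R ⊑T Φ
    restrict-⊑ R⊆ = (⊆-refl , ⊆-refl) , closure-pos R⊆

next-pos : ∀ {Φ Φ′ g} → Φ Sᵀ Φ′ → g ∈ pos Φ → next Φ g ⊆ pos Φ′
next-pos {g = ○ a} ΦSΦ′ g∈ (here refl) = _Sᵀ_.○-pos ΦSΦ′ g∈
next-pos {Φ} {g = ◇ a} ΦSΦ′ g∈ m with a ∈? pos Φ | _Sᵀ_.◇-pos ΦSΦ′ g∈
next-pos {Φ} {g = ◇ a} ΦSΦ′ g∈ () | yes _ | _
next-pos {Φ} {g = ◇ a} ΦSΦ′ g∈ m | no a∉ | inj₁ a∈ = ⊥-elim (a∉ a∈)
next-pos {Φ} {g = ◇ a} ΦSΦ′ g∈ (here refl) | no _ | inj₂ ◇a∈ = ◇a∈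

obligations-pos : ∀ {Φ Φ′ R} → IsType Φ → Φ Sᵀ Φ′ → R ⊆ pos Φ → obligations Φ R ⊆ pos Φ′
obligations-pos {Φ} {R = R} Φ-type ΦSΦ′ R⊆ m with find (∈-concatMap⁻ (next Φ) {xs = closure Φ R} m)
... | g , g∈ , m′ = next-pos ΦSΦ′ (closure-pos Φ Φ-type R⊆ g∈) m′

restrict-S : ∀ {Φ Φ′ R R′} → Φ Sᵀ Φ′ → obligations Φ R ⊆ R′ → restrict Φ R Sᵀ restrict Φ′ R′
restrict-S {Φ} {Φ′} {R} {R′} ΦSΦ′ obl⊆ = record
  { ○-pos = ⊆-closure Φ′ R′ ∘ obl⊆ ∘ ○-obligation Φ R
  ; ○-neg = _Sᵀ_.○-neg ΦSΦ′
  ; ◇-pos = λ m → Sum.map₂ (λ a∉ → ⊆-closure Φ′ R′ (obl⊆ (◇-obligation Φ R m a∉)))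
                           (closure-saturated Φ R m)
  ; ◇-neg = _Sᵀ_.◇-neg ΦSΦ′
  }

-- Termination measure: the total size of a finite set of requirements.
size : Form → ℕ
size ⊥'       = 1
size (var _)  = 1
size (a ∧' b) = suc (size a + size b)
size (a ∨' b) = suc (size a + size b)
size (a ⇒' b) = suc (size a + size b)
size (○ a)    = suc (size a)
size (◇ a)    = suc (size a)

weight : List Form → ℕ
weight C = sum (map size C)

weight-++ : ∀ C D → weight (C ++ D) ≡ weight C + weight D
weight-++ C D = trans (cong sum (map-++ size C D)) (sum-++ (map size C) (map size D))

-- A ◇-formula whose argument is not (yet) true: it is passed on unchanged.
data Pending (Φ : Pair) : Form → Set where
  pending : ∀ {a} → ¬ a ∈ pos Φ → Pending Φ (◇ a)

module _ (Φ : Pair) where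

  demand : Form → List Form
  demand f = concatMap (next Φ) (cl Φ f)

  weight-next-++ : ∀ C D → weight (concatMap (next Φ) (C ++ D)) ≡
                           weight (concatMap (next Φ) C) + weight (concatMap (next Φ) D)
  weight-next-++ C D =
    trans (cong weight (concatMap-++ (next Φ) C D)) (weight-++ (concatMap (next Φ) C) (concatMap (next Φ) D))

  mutual
    demand-< : ∀ f → weight (demand f) < size f ⊎ Pending Φ f
    demand-< ⊥'       = inj₁ (s≤s z≤n)
    demand-< (var n)  = inj₁ (s≤s z≤n)
    demand-< (a ∧' b) =
      inj₁ (s≤s (≤-trans (≤-reflexive (weight-next-++ (cl Φ a) (cl Φ b))) (+-mono-≤ (demand-≤ a) (demand-≤ b))))
    demand-< (a ∨' b) with a ∈? pos Φ
    ... | yes _ = inj₁ (s≤s (≤-trans (demand-≤ a) (m≤m+n _ _)))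
    ... | no  _ = inj₁ (s≤s (≤-trans (demand-≤ b) (m≤n+m _ _)))
    demand-< (a ⇒' b) with b ∈? pos Φ
    ... | yes _ = inj₁ (s≤s (≤-trans (demand-≤ b) (m≤n+m _ _)))
    ... | no  _ = inj₁ (s≤s z≤n)
    demand-< (○ a)    = inj₁ (s≤s (≤-reflexive (+-identityʳ (size a))))
    demand-< (◇ a) with a ∈? pos Φ
    ... | yes _  = inj₁ (s≤s (demand-≤ a))
    ... | no  a∉ = inj₂ (pending a∉)

    demand-≤ : ∀ f → weight (demand f) ≤ size f
    demand-≤ f with demand-< f
    ... | inj₁ lt          = <⇒≤ lt
    ... | inj₂ (pending a∉) = pending-weight a∉

    pending-weight : ∀ {a} → ¬ a ∈ pos Φ → weight (demand (◇ a)) ≤ size (◇ a)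
    pending-weight {a} a∉ with a ∈? pos Φ
    ... | yes a∈ = ⊥-elim (a∉ a∈)
    ... | no  _  = ≤-reflexive (+-identityʳ (size (◇ a)))

  ◇-fulfilled : ∀ {a} → a ∈ pos Φ → weight (demand (◇ a)) < size (◇ a)
  ◇-fulfilled {a} a∈ with demand-< (◇ a)
  ... | inj₁ lt          = lt
  ... | inj₂ (pending a∉) = ⊥-elim (a∉ a∈)

  obligations-∷ : ∀ f R → weight (obligations Φ (f ∷ R)) ≡ weight (demand f) + weight (obligations Φ R)
  obligations-∷ f R = weight-next-++ (cl Φ f) (closure Φ R)

  obligations-≤ : ∀ R → weight (obligations Φ R) ≤ weight R
  obligations-≤ []      = z≤n
  obligations-≤ (f ∷ R) = ≤-trans (≤-reflexive (obligations-∷ f R)) (+-mono-≤ (demand-≤ f) (obligations-≤ R))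

  obligations-< : ∀ {g} R → g ∈ R → weight (demand g) < size g → weight (obligations Φ R) < weight R
  obligations-< (f ∷ R) (here refl) lt =
    ≤-trans (≤-reflexive (cong suc (obligations-∷ f R))) (+-mono-<-≤ lt (obligations-≤ R))
  obligations-< (f ∷ R) (there m)   lt =
    ≤-trans (≤-reflexive (cong suc (obligations-∷ f R))) (+-mono-≤-< (demand-≤ f) (obligations-< R m lt))

module Discharging {W : Set} {_≈_ _≼_ S : Rel W 0ℓ} {ℓ : W → Pair} (Q : IsQuasimodel _≈_ _≼_ S ℓ) where
  open IsQuasimodel Q
  open IsLabelledFrame isLabelledFrame

  P : W → List Form
  P v = pos (ℓ v)

  -- A finite S-path from v along which the requirements R (true at v)
  -- are discharged: each step passes the obligations on to requirements
  -- true at the successor, and the path ends with no requirements left.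
  data Discharge : W → List Form → Set where
    done : ∀ {v} → Discharge v []
    step : ∀ {v v′ R R′} → S v v′ → obligations (ℓ v) R ⊆ R′ → R′ ⊆ P v′ →
           Discharge v′ R′ → Discharge v R

  -- The fuel n bounds
  -- the weight of R; a pending ◇χ is handled by following the S-path to
  -- a world where χ holds, given by ω-sensibility, along which the weight
  -- does not grow.
  mutual
    discharge : ∀ n {v R} → R ⊆ P v → weight R < n → Discharge v R
    discharge zero    R⊆ ()
    discharge (suc n) {R = []} R⊆ lt = done
    discharge (suc n) {v} {f ∷ R} R⊆ (s≤s lt) with demand-< (ℓ v) f
    ... | inj₁ f-shrinks = advance n R⊆ (<-≤-trans (obligations-< (ℓ v) (f ∷ R) (here refl) f-shrinks) lt)
    ... | inj₂ (pending _) with ω-sensible (R⊆ (here refl))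
    ...   | k , u , v⇝u , χ∈u = await n k v⇝u χ∈u (here refl) R⊆ lt

    advance : ∀ n {v R} → R ⊆ P v → weight (obligations (ℓ v) R) < n → Discharge v R
    advance n {v} {R} R⊆ lt = step v→v′ ⊆-refl obl⊆ (discharge n obl⊆ lt)
      where
      v→v′ : S v (proj₁ (serial v))
      v→v′ = proj₂ (serial v)
      obl⊆ : obligations (ℓ v) R ⊆ P (proj₁ (serial v))
      obl⊆ = obligations-pos (ℓ-type v) (sensible v→v′) R⊆

    await : ∀ n k {v u R χ} → (S ^ k) v u → χ ∈ P u → ◇ χ ∈ R → R ⊆ P v → weight R ≤ n → Discharge v R
    await n k {v} {R = R} {χ = χ} v⇝u χ∈u ◇χ∈R R⊆ le with χ ∈? P v
    ... | yes χ∈v = advance n R⊆ (<-≤-trans (obligations-< (ℓ v) R ◇χ∈R (◇-fulfilled (ℓ v) χ∈v)) le)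
    await n zero refl χ∈u ◇χ∈R R⊆ le | no χ∉v = ⊥-elim (χ∉v χ∈u)
    await n (suc k) {v} {R = R} {χ} (v′ , v→v′ , v′⇝u) χ∈u ◇χ∈R R⊆ le | no χ∉v =
      step v→v′ ⊆-refl obl⊆ (await n k v′⇝u χ∈u ◇χ∈obl obl⊆ (≤-trans (obligations-≤ (ℓ v) R) le))
      where
      obl⊆ : obligations (ℓ v) R ⊆ P v′
      obl⊆ = obligations-pos (ℓ-type v) (sensible v→v′) R⊆
      ◇χ∈obl : ◇ χ ∈ obligations (ℓ v) R
      ◇χ∈obl = ◇-obligation (ℓ v) R (⊆-closure (ℓ v) R ◇χ∈R) χ∉v

  discharged : ∀ {v R} → R ⊆ P v → Discharge v R
  discharged {R = R} R⊆ = discharge (suc (weight R)) R⊆ ≤-refl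

  module Paths (U : List Form) where
    open WeakLimit _≈_ _≼_ S ℓ U

    Link : Node → Node → Set
    Link x y = S (proj₁ x) (proj₁ y) × proj₂ x Sᵀ proj₂ y

    Typed : Node → Set
    Typed x = IsType (proj₂ x) × proj₂ x ⊑T ℓ (proj₁ x)

    mutual
      nodes : ∀ {v R} → Discharge v R → List Node
      nodes {v} {R} d = (v , restrict (ℓ v) R) ∷ later d

      later : ∀ {v R} → Discharge v R → List Node
      later done             = []
      later (step _ _ _ d) = nodes d

    nodes-linked : ∀ {v R} (d : Discharge v R) → Linked Link (nodes d)
    nodes-linked done                      = [-]
    nodes-linked (step {R = R} {R′} v→v′ obl⊆ _ d) =
      (v→v′ , restrict-S {R = R} {R′} (sensible v→v′) obl⊆) ∷ nodes-linked d

    restrict-typed : ∀ {v R} → R ⊆ P v → Typed (v , restrict (ℓ v) R)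
    restrict-typed {v} R⊆ = restrict-type (ℓ v) (ℓ-type v) R⊆ , restrict-⊑ (ℓ v) (ℓ-type v) R⊆

    nodes-typed : ∀ {v R} → R ⊆ P v → (d : Discharge v R) → All Typed (nodes d)
    nodes-typed R⊆ done               = restrict-typed R⊆ ∷ []
    nodes-typed R⊆ (step _ _ R′⊆ d) = restrict-typed R⊆ ∷ nodes-typed R′⊆ d

    -- the last type has the closure of no requirements, i.e. nothing, as positive part
    nodes-terminal : ∀ {v R} (d : Discharge v R) → IsTerminal (nodes d)
    nodes-terminal done = [] , _ , refl , refl
    nodes-terminal {v} {R} (step _ _ _ d) with nodes-terminal d
    ... | xs , x , nodes≡ , x-final = (v , restrict (ℓ v) R) ∷ xs , x , cong (_ ∷_) nodes≡ , x-final

    toŴ : ∀ {v R} → R ⊆ P v → Discharge v R → Ŵ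
    toŴ R⊆ d = nodes d , (nodes-linked d , nodes-typed R⊆ d) , inj₂ (nodes-terminal d)

    Below : Node → Node → Set
    Below x y = proj₁ x ≼ proj₁ y × proj₂ x ≼T proj₂ y

    head-below : ∀ {w Φ v R} → Φ ⊑T ℓ w → w ≼ v → pos Φ ⊆ R → Below (w , Φ) (v , restrict (ℓ v) R)
    head-below {R = R} ((_ , ℓw⊆Φ) , _) w≼v Φ⊆R = w≼v , ℓw⊆Φ ∘ proj₁ (ℓ-mono w≼v) , ⊆-closure _ R ∘ Φ⊆R

    -- A typed path starting at a world below v, whose first positive part
    -- is among the requirements R, is a prefix (in the order of Ŵ) of a
    -- discharge of R from v: follow the path upwards by forward
    -- confluence, adding its positive parts to the requirements, then
    -- discharge what is left.
    extend : ∀ {w Φ xs v R} → Linked Link ((w , Φ) ∷ xs) → All Typed ((w , Φ) ∷ xs) →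
             w ≼ v → pos Φ ⊆ R → R ⊆ P v →
             Σ (Discharge v R) λ d → Prefix Below ((w , Φ) ∷ xs) (nodes d)
    extend {xs = []} _ ((_ , Φ⊑) ∷ []) w≼v Φ⊆R R⊆ = discharged R⊆ , head-below Φ⊑ w≼v Φ⊆R ∷ []
    extend {xs = (w′ , Φ′) ∷ _} {v} {R} ((w→w′ , _) ∷ linked) ((_ , Φ⊑) ∷ typed@((_ , Φ′⊑) ∷ _)) w≼v Φ⊆R R⊆
      with forward-confluent w≼v w→w′
    ... | v′ , w′≼v′ , v→v′ =
      let d , d-extends = extend linked typed w′≼v′ (∈-++⁺ʳ (obligations (ℓ v) R)) R′⊆
      in step v→v′ ∈-++⁺ˡ R′⊆ d , head-below Φ⊑ w≼v Φ⊆R ∷ d-extends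
      where
      R′⊆ : obligations (ℓ v) R ++ pos Φ′ ⊆ P v′
      R′⊆ m with ∈-++⁻ (obligations (ℓ v) R) m
      ... | inj₁ m′ = obligations-pos (ℓ-type v) (sensible v→v′) R⊆ m′
      ... | inj₂ m′ = proj₂ (ℓ-mono w′≼v′) (proj₂ Φ′⊑ m′)

≼T-isPartialOrder : IsPartialOrder _≐T_ _≼T_
≼T-isPartialOrder = record
  { isPreorder = record
    { isEquivalence = record
      { refl  = (⊆-refl , ⊆-refl) , (⊆-refl , ⊆-refl)
      ; sym   = λ ((n , n′) , (p , p′)) → (n′ , n) , (p′ , p)
      ; trans = λ ((n₁ , n₁′) , (p₁ , p₁′)) ((n₂ , n₂′) , (p₂ , p₂′)) →
                  ((λ m → n₂ (n₁ m)) , (λ m → n₁′ (n₂′ m))) , ((λ m → p₂ (p₁ m)) , (λ m → p₁′ (p₂′ m)))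
      }
    ; reflexive = λ ((_ , n′) , (p , _)) → n′ , p
    ; trans     = λ (n₁ , p₁) (n₂ , p₂) → (λ m → n₁ (n₂ m)) , (λ m → p₂ (p₁ m))
    }
  ; antisym = λ (n₁ , p₁) (n₂ , p₂) → (n₂ , n₁) , (p₁ , p₂)
  }

union-type : ∀ {W : Set} {ℓ : W → Pair} {U} → (∀ w → IsType (ℓ w)) → UnionListing ℓ U → IsType ⟨ U ⨾ [] ⟩
union-type {W} {ℓ} {U} ℓ-type (U⊆ , ⊆U) = record
  { disjoint = λ _ ()
  ; ⊥∉pos    = λ ()
  ; ∧-pos    = λ ()
  ; ∧-neg    = λ m → Sum.map ⊆U ⊆U (IsType.∧-neg (ℓ-type (world m)) (proj₂ (U⊆ m)))
  ; ∨-pos    = λ ()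
  ; ∨-neg    = λ m → let a∈ , b∈ = IsType.∨-neg (ℓ-type (world m)) (proj₂ (U⊆ m)) in ⊆U a∈ , ⊆U b∈
  ; ⇒-pos    = λ ()
  ; ◇-neg    = λ m → ⊆U (IsType.◇-neg (ℓ-type (world m)) (proj₂ (U⊆ m)))
  }
  where
  world : ∀ {φ} → φ ∈ U → W
  world m = proj₁ (U⊆ m)

module LimitProperties {W : Set} {_≈_ _≼_ S : Rel W 0ℓ} {ℓ : W → Pair}
                       (Q : IsQuasimodel _≈_ _≼_ S ℓ) (U : List Form) (UL : UnionListing ℓ U) where
  open IsQuasimodel Q
  open IsLabelledFrame isLabelledFrame
  open WeakLimit _≈_ _≼_ S ℓ U
  open Discharging Q
  open Paths U

  U⊆ : ∀ {φ} → φ ∈ U → ∃[ w ] (φ ∈ neg (ℓ w))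
  U⊆ = proj₁ UL

  ⊆U : ∀ {w φ} → φ ∈ neg (ℓ w) → φ ∈ U
  ⊆U = proj₂ UL

  Ŵ-isPartialOrder : IsPartialOrder _≈̂_ _≼̂_
  Ŵ-isPartialOrder = On.isPartialOrder path (Prefix.isPartialOrder (×-isPartialOrder isPartialOrder ≼T-isPartialOrder))

  ℓ̂-type : ∀ α → IsType (ℓ̂ α)
  ℓ̂-type ([] , _)                             = union-type ℓ-type UL
  ℓ̂-type ((_ ∷ _) , (_ , (Φ-type , _) ∷ _) , _) = Φ-type

  -- labels grow along the order; the label of ε refutes everything refuted anywhere
  ℓ̂-mono : ∀ {α β} → α ≼̂ β → ℓ̂ α ≼T ℓ̂ β
  ℓ̂-mono {[] , _} {[] , _}                            []           = ⊆-refl , ⊆-refl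
  ℓ̂-mono {[] , _} {(_ ∷ _) , (_ , (_ , Φ⊑) ∷ _) , _} []           = ⊆U ∘ proj₁ (proj₁ Φ⊑) , λ ()
  ℓ̂-mono {(_ ∷ _) , _} {(_ ∷ _) , _}                  ((_ , Φ≼Ψ) ∷ _) = Φ≼Ψ

  -- A refuted implication is witnessed by the discharge of the antecedent
  -- at the witnessing world of Q (together with the current path, if any).
  ℓ̂-⇒ : ∀ {α φ ψ} → (φ ⇒' ψ) ∈ neg (ℓ̂ α) → ∃[ β ] (α ≼̂ β × φ ∈ pos (ℓ̂ β) × ψ ∈ neg (ℓ̂ β))
  ℓ̂-⇒ {[] , _} {φ} m with ℓ-⇒ (proj₂ (U⊆ m))
  ... | v , _ , φ∈v , ψ∉v = toŴ φ⊆ (discharged φ⊆) , [] , ⊆-closure (ℓ v) (φ ∷ []) (here refl) , ψ∉v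
    where
    φ⊆ : (φ ∷ []) ⊆ P v
    φ⊆ (here refl) = φ∈v
  ℓ̂-⇒ {((w , Φ) ∷ _) , (linked , typed@((_ , Φ⊑) ∷ _)) , _} {φ} m with ℓ-⇒ (proj₁ (proj₁ Φ⊑) m)
  ... | v , w≼v , φ∈v , ψ∉v =
    toŴ φΦ⊆ (proj₁ ext) , proj₂ ext , ⊆-closure (ℓ v) (φ ∷ pos Φ) (here refl) , ψ∉v
    where
    φΦ⊆ : (φ ∷ pos Φ) ⊆ P v
    φΦ⊆ (here refl) = φ∈v
    φΦ⊆ (there m′)  = proj₂ (ℓ-mono w≼v) (proj₂ Φ⊑ m′)
    ext : Σ (Discharge v (φ ∷ pos Φ)) λ d → Prefix Below ((w , Φ) ∷ _) (nodes d)
    ext = extend linked typed w≼v there φΦ⊆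

  singleton-terminal : ∀ {x} → IsTerminal (x ∷ []) → pos (proj₂ x) ≡ []
  singleton-terminal {x} (ys , y , x∷[]≡ , y-final) =
    subst (λ z → pos (proj₂ z) ≡ []) (sym (proj₂ (∷ʳ-injective [] ys x∷[]≡))) y-final

  no-pos : ∀ {Φ g} → pos Φ ≡ [] → ¬ g ∈ pos Φ
  no-pos empty = ∉[] ∘ subst (_ ∈_) empty

  -- A type with no positive formulas, refuting only formulas of U, is
  -- S_T-related to the label of ε; for ○ this uses seriality and sensibility.
  to-ε-S : ∀ {Φ} → pos Φ ≡ [] → neg Φ ⊆ U → Φ Sᵀ ⟨ U ⨾ [] ⟩
  to-ε-S {Φ} empty Φ⊆U = record
    { ○-pos = λ m → ⊥-elim (no-pos {Φ} empty m)
    ; ○-neg = λ m → let w , ○a∉w = U⊆ (Φ⊆U m) in ⊆U (_Sᵀ_.○-neg (sensible (proj₂ (serial w))) ○a∉w)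
    ; ◇-pos = λ m → ⊥-elim (no-pos {Φ} empty m)
    ; ◇-neg = Φ⊆U
    }

  Ŝ-sensible : ∀ α → ℓ̂ α Sᵀ ℓ̂ (Ŝ α)
  Ŝ-sensible ([] , _)                                        = to-ε-S refl ⊆-refl
  Ŝ-sensible ((_ ∷ _) , (_ , _ ∷ _) , inj₁ ())
  Ŝ-sensible ((_ ∷ []) , (_ , (_ , Φ⊑) ∷ _) , inj₂ terminal)   =
    to-ε-S (singleton-terminal terminal) (⊆U ∘ proj₁ (proj₁ Φ⊑))
  Ŝ-sensible ((_ ∷ _ ∷ _) , ((_ , ΦSΨ) ∷ _ , _ ∷ _) , inj₂ _) = ΦSΨ

  Ŝ-forward-confluent : ∀ {α α′ β} → α ≼̂ α′ → Ŝ α ≡ β → ∃[ β′ ] (β ≼̂ β′ × Ŝ α′ ≡ β′)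
  Ŝ-forward-confluent {[] , _} {α′} _ refl = Ŝ α′ , [] , refl
  Ŝ-forward-confluent {(_ ∷ _) , (_ , _ ∷ _) , inj₁ ()}
  Ŝ-forward-confluent {(_ ∷ _) , (_ , _ ∷ _) , inj₂ _} {(_ ∷ _) , (_ , _ ∷ _) , inj₁ ()}
  Ŝ-forward-confluent {(_ ∷ _) , (_ , _ ∷ _) , inj₂ _} {α′@((_ ∷ _) , (_ , _ ∷ _) , inj₂ _)} (_ ∷ tail≼) refl =
    Ŝ α′ , tail≼ , refl

  Reaches : Ŵ → Form → Set
  Reaches α φ = ∃[ n ] ∃[ β ] ((_Ŝ-rel_ ^ n) α β × φ ∈ pos (ℓ̂ β))

  reaches-back : ∀ {α φ} → Reaches (Ŝ α) φ → Reaches α φ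
  reaches-back {α} (n , β , steps , φ∈) = suc n , β , (Ŝ α , refl , steps) , φ∈

  -- A ◇φ in the first type of a path is fulfilled further along the path,
  -- since its last type has no positive formulas.
  Ŝ-ω-sensible : ∀ xs typed end {φ} → ◇ φ ∈ pos (ℓ̂ (xs , typed , end)) → Reaches (xs , typed , end) φ
  Ŝ-ω-sensible []            _             _               ()
  Ŝ-ω-sensible (_ ∷ _)       (_ , _ ∷ _)   (inj₁ ())       _
  Ŝ-ω-sensible (x ∷ [])      (_ , _ ∷ _)   (inj₂ terminal) m = ⊥-elim (no-pos {proj₂ x} (singleton-terminal terminal) m)
  Ŝ-ω-sensible (x ∷ y ∷ ys) ((r , ΦSΨ) ∷ linked , px ∷ typed) (inj₂ t) {φ} m =
    fulfil (_Sᵀ_.◇-pos ΦSΨ m) (Ŝ-ω-sensible (y ∷ ys) (linked , typed) (proj₂ (proj₂ (Ŝ α))))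
    where
    α : Ŵ
    α = x ∷ y ∷ ys , ((r , ΦSΨ) ∷ linked , px ∷ typed) , inj₂ t
    fulfil : φ ∈ pos (proj₂ x) ⊎ ◇ φ ∈ pos (proj₂ y) →
             (◇ φ ∈ pos (proj₂ y) → Reaches (Ŝ α) φ) → Reaches α φ
    fulfil (inj₁ φ∈)  _     = 0 , α , refl , φ∈
    fulfil (inj₂ ◇φ∈) onward = reaches-back {α} (onward ◇φ∈)

lemma8p8 : {W : Set} {_≈_ _≼_ S : Rel W 0ℓ} {ℓ : W → Pair} →
           IsQuasimodel _≈_ _≼_ S ℓ →
           (U : List Form) → UnionListing ℓ U →
           IsDeterministicQuasimodel
             (WeakLimit._≈̂_ _≈_ _≼_ S ℓ U)
             (WeakLimit._≼̂_ _≈_ _≼_ S ℓ U)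
             (WeakLimit._Ŝ-rel_ _≈_ _≼_ S ℓ U)
             (WeakLimit.ℓ̂ _≈_ _≼_ S ℓ U)
lemma8p8 {_≈_ = _≈_} {_≼_} {S} {ℓ} Q U UL = record
  { isQuasimodel = record
    { isLabelledFrame   = record
      { isPartialOrder = Ŵ-isPartialOrder
      ; ℓ-type         = ℓ̂-type
      ; ℓ-mono         = ℓ̂-mono
      ; ℓ-⇒            = ℓ̂-⇒
      }
    ; serial            = λ α → Ŝ α , refl
    ; forward-confluent = Ŝ-forward-confluent
    ; sensible          = λ { {α} refl → Ŝ-sensible α }
    ; ω-sensible        = λ { {xs , typed , end} → Ŝ-ω-sensible xs typed end }
    }
  ; functional = λ { {α} refl refl → IsPartialOrder.Eq.refl Ŵ-isPartialOrder {Ŝ α} }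
  }
  where
  open WeakLimit _≈_ _≼_ S ℓ U using (Ŝ)
  open LimitProperties Q U UL
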